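{- Let $G$ be a finite group (written additively, not necessarily abelian) of order $q$, let $f:G\to G$ with $V(f)=v$, and let $k$ be an integer with $1\le k\le q$. If \[q\sum_{i=0}^{k}(-1)^i\binom{k}{i}\frac{\binom{v}{i}}{\binom{q}{i}}<1,\] then there exists a cover of $G$ associated with $f$ of cardinality $k$.
   Context: $V(f)=\#\{f(x):x\in G\}$ and $\operatorname{Im}(f)=\{f(x):x\in G\}$. The subtraction table $M_f$ has rows indexed by $G$, columns indexed by $\operatorname{Im}(f)$, and entry $m_{r,c}=r-c$ at position $(r,c)$. For $S\subseteq G$, $\operatorname{Range}(M_S)=\{r\in G: m_{r,c}\in S \text{ for some } c\in\operatorname{Im}(f)\}$, the set of rows of $M_f$ containing an entry whose value lies in $S$. A subset $S\subseteq G$ is a cover of $G$ associated with $f$ if $\operatorname{Range}(M_S)=G$, i.e. for every $r\in G$ there is $c\in\operatorname{Im}(f)$ with $r-c\in S$. -}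

module Defs where

open import Data.Nat using (ℕ; zero; suc)
open import Data.Nat.Combinatorics using (_C_)
open import Data.Integer using (+_)
open import Data.Rational using (ℚ; _/_; 0ℚ; 1ℚ; -_; _+_; _*_)
open import Data.Fin using (Fin)
open import Data.Fin.Properties using (_≟_; any?)
open import Data.Fin.Subset using (Subset; ∣_∣)
open import Data.Vec using (tabulate)
open import Relation.Nullary using (does)

Im : ∀ {q} → (Fin q → Fin q) → Subset q
Im f = tabulate (λ y → does (any? (λ x → f x ≟ y)))

V : ∀ {q} → (Fin q → Fin q) → ℕ
V f = ∣ Im f ∣

-- n / d as a rational; only used with d ≠ 0 (for d = 0 it returns 0).
ratio : ℕ → ℕ → ℚ
ratio n zero    = 0ℚ
ratio n (suc d) = (+ n) / suc d

sgn : ℕ → ℚ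
sgn zero    = 1ℚ
sgn (suc i) = - sgn i

sumTo : ℕ → (ℕ → ℚ) → ℚ
sumTo zero    g = g 0
sumTo (suc k) g = sumTo k g + g (suc k)

bound : (q v k : ℕ) → ℚ
bound q v k =
  ((+ q) / 1) * sumTo k (λ i → sgn i * (((+ (k C i)) / 1) * ratio (v C i) (q C i)))

{-# OPTIONS --safe #-}
-- Double counting over the k-subsets S of G.  S covers r exactly when it meets row r of the
-- subtraction table, { r − c : c ∈ Im f }, a set of v elements; so r is missed by exactly
-- C(q−v,k) of the C(q,k) subsets of size k, and there are q·C(q−v,k) pairs (S, r) with S
-- missing r.  By inclusion–exclusion, Σᵢ (−1)ⁱ C(v,i) C(q−i,k−i) = C(q−v,k), and since
-- C(q,i) C(q−i,k−i) = C(q,k) C(k,i), that number is the left-hand side of the hypothesis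
-- times C(q,k), hence smaller than C(q,k): some subset of size k misses no r.
module Submission where

open import Defs
open import Data.Fin using (Fin)
open import Data.Fin.Subset using (Subset; _∈_; ∣_∣)
open import Algebra.Core using (Op₁; Op₂)
open import Algebra.Structures using (IsGroup)
open import Relation.Binary.PropositionalEquality using (_≡_; refl)

module Binomial where
  open import Data.Nat
  open import Data.Nat.Properties
  open import Data.Nat.Combinatorics
  open import Data.Nat.DivMod using (m/n*n≡m)
  open import Data.Nat.Solver using (module +-*-Solver)
  open import Relation.Binary.PropositionalEquality
  open +-*-Solver using (solve; _:*_; _:=_)

  nCk*[k!*[n∸k]!]≡n! : ∀ {n k} → k ≤ n → (n C k) * (k ! * (n ∸ k) !) ≡ n !
  nCk*[k!*[n∸k]!]≡n! {n} {k} k≤n = begin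
    (n C k) * (k ! * (n ∸ k) !)
      ≡⟨ cong (_* (k ! * (n ∸ k) !)) (nCk≡n!/k![n-k]! k≤n) ⟩
    (n ! / (k ! * (n ∸ k) !)) * (k ! * (n ∸ k) !)
      ≡⟨ m/n*n≡m (k![n∸k]!∣n! k≤n) ⟩
    n ! ∎
    where
    open ≡-Reasoning
    instance _ = k !* (n ∸ k) !≢0

  nCk≢0 : ∀ {n k} → k ≤ n → NonZero (n C k)
  nCk≢0 {n} {k} k≤n =
    m*n≢0⇒m≢0 (n C k) {{subst NonZero (sym (nCk*[k!*[n∸k]!]≡n! k≤n)) (n !≢0)}}

  [n∸i]∸[k∸i]≡n∸k : ∀ n {i k} → i ≤ k → (n ∸ i) ∸ (k ∸ i) ≡ n ∸ k
  [n∸i]∸[k∸i]≡n∸k n {i} {k} i≤k = trans (∸-+-assoc n i (k ∸ i)) (cong (n ∸_) (m+[n∸m]≡n i≤k))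

  nCi*[n∸i]C[k∸i]≡nCk*kCi : ∀ {n k i} → i ≤ k → k ≤ n →
                            (n C i) * ((n ∸ i) C (k ∸ i)) ≡ (n C k) * (k C i)
  nCi*[n∸i]C[k∸i]≡nCk*kCi {n} {k} {i} i≤k k≤n =
    *-cancelʳ-≡ _ _ (i ! * (k ∸ i) ! * (n ∸ k) !) (trans lhs (sym rhs))
    where
    open ≡-Reasoning
    instance _ = m*n≢0 _ _ {{i !* (k ∸ i) !≢0}} {{(n ∸ k) !≢0}}
    [n∸i]C[k∸i]*[[k∸i]!*[n∸k]!]≡[n∸i]! :
      ((n ∸ i) C (k ∸ i)) * ((k ∸ i) ! * (n ∸ k) !) ≡ (n ∸ i) !
    [n∸i]C[k∸i]*[[k∸i]!*[n∸k]!]≡[n∸i]! =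
      subst (λ m → ((n ∸ i) C (k ∸ i)) * ((k ∸ i) ! * m !) ≡ (n ∸ i) !) ([n∸i]∸[k∸i]≡n∸k n i≤k)
            (nCk*[k!*[n∸k]!]≡n! (∸-monoˡ-≤ i k≤n))
    lhs : (n C i) * ((n ∸ i) C (k ∸ i)) * (i ! * (k ∸ i) ! * (n ∸ k) !) ≡ n !
    lhs = begin
      (n C i) * ((n ∸ i) C (k ∸ i)) * (i ! * (k ∸ i) ! * (n ∸ k) !)
        ≡⟨ solve 5 (λ a b x y z → a :* b :* (x :* y :* z) := a :* (x :* (b :* (y :* z)))) refl
                 (n C i) ((n ∸ i) C (k ∸ i)) (i !) ((k ∸ i) !) ((n ∸ k) !) ⟩
      (n C i) * (i ! * (((n ∸ i) C (k ∸ i)) * ((k ∸ i) ! * (n ∸ k) !)))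
        ≡⟨ cong (λ m → (n C i) * (i ! * m)) [n∸i]C[k∸i]*[[k∸i]!*[n∸k]!]≡[n∸i]! ⟩
      (n C i) * (i ! * (n ∸ i) !)
        ≡⟨ nCk*[k!*[n∸k]!]≡n! (≤-trans i≤k k≤n) ⟩
      n ! ∎
    rhs : (n C k) * (k C i) * (i ! * (k ∸ i) ! * (n ∸ k) !) ≡ n !
    rhs = begin
      (n C k) * (k C i) * (i ! * (k ∸ i) ! * (n ∸ k) !)
        ≡⟨ solve 5 (λ a b x y z → a :* b :* (x :* y :* z) := a :* (b :* (x :* y) :* z)) refl
                 (n C k) (k C i) (i !) ((k ∸ i) !) ((n ∸ k) !) ⟩
      (n C k) * ((k C i) * (i ! * (k ∸ i) !) * (n ∸ k) !)
        ≡⟨ cong (λ m → (n C k) * (m * (n ∸ k) !)) (nCk*[k!*[n∸k]!]≡n! i≤k) ⟩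
      (n C k) * (k ! * (n ∸ k) !)
        ≡⟨ nCk*[k!*[n∸k]!]≡n! k≤n ⟩
      n ! ∎

module Embedding where
  open import Data.Nat as ℕ using (ℕ; suc)
  open import Data.Integer as ℤ using (+_)
  import Data.Integer.Properties as ℤ
  open import Data.Rational
  open import Data.Rational.Properties
  import Data.Rational.Unnormalised as ℚᵘ
  import Data.Rational.Unnormalised.Properties as ℚᵘ
  open import Data.Nat.Coprimality using (1-coprimeTo; sym)
  open import Relation.Binary.PropositionalEquality hiding (sym)
  import Relation.Binary.PropositionalEquality as ≡

  toℚ : ℕ → ℚ
  toℚ n = + n / 1

  toℚ≡mkℚ : ∀ n → toℚ n ≡ mkℚ (+ n) 0 (sym (1-coprimeTo n))
  toℚ≡mkℚ n = normalize-coprime (sym (1-coprimeTo n))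

  toℚᵘ-toℚ : ∀ n → toℚᵘ (toℚ n) ≡ ℚᵘ.mkℚᵘ (+ n) 0
  toℚᵘ-toℚ n = cong toℚᵘ (toℚ≡mkℚ n)

  toℚ-+ : ∀ m n → toℚ (m ℕ.+ n) ≡ toℚ m + toℚ n
  toℚ-+ m n = toℚᵘ-injective (begin
    toℚᵘ (toℚ (m ℕ.+ n))
      ≡⟨ toℚᵘ-toℚ (m ℕ.+ n) ⟩
    ℚᵘ.mkℚᵘ (+ (m ℕ.+ n)) 0
      ≈⟨ ℚᵘ.*≡* (cong (ℤ._* + 1) +[m+n]≡+m*1++n*1) ⟩
    ℚᵘ.mkℚᵘ (+ m) 0 ℚᵘ.+ ℚᵘ.mkℚᵘ (+ n) 0
      ≡⟨ cong₂ ℚᵘ._+_ (toℚᵘ-toℚ m) (toℚᵘ-toℚ n) ⟨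
    toℚᵘ (toℚ m) ℚᵘ.+ toℚᵘ (toℚ n)
      ≈⟨ toℚᵘ-homo-+ (toℚ m) (toℚ n) ⟨
    toℚᵘ (toℚ m + toℚ n) ∎)
    where
    open ℚᵘ.≃-Reasoning
    +[m+n]≡+m*1++n*1 : + (m ℕ.+ n) ≡ + m ℤ.* + 1 ℤ.+ + n ℤ.* + 1
    +[m+n]≡+m*1++n*1 =
      trans (ℤ.pos-+ m n) (≡.sym (cong₂ ℤ._+_ (ℤ.*-identityʳ (+ m)) (ℤ.*-identityʳ (+ n))))

  toℚ-* : ∀ m n → toℚ (m ℕ.* n) ≡ toℚ m * toℚ n
  toℚ-* m n = toℚᵘ-injective (begin
    toℚᵘ (toℚ (m ℕ.* n))
      ≡⟨ toℚᵘ-toℚ (m ℕ.* n) ⟩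
    ℚᵘ.mkℚᵘ (+ (m ℕ.* n)) 0
      ≈⟨ ℚᵘ.*≡* (cong (ℤ._* + 1) (ℤ.pos-* m n)) ⟩
    ℚᵘ.mkℚᵘ (+ m) 0 ℚᵘ.* ℚᵘ.mkℚᵘ (+ n) 0
      ≡⟨ cong₂ ℚᵘ._*_ (toℚᵘ-toℚ m) (toℚᵘ-toℚ n) ⟨
    toℚᵘ (toℚ m) ℚᵘ.* toℚᵘ (toℚ n)
      ≈⟨ toℚᵘ-homo-* (toℚ m) (toℚ n) ⟨
    toℚᵘ (toℚ m * toℚ n) ∎)
    where open ℚᵘ.≃-Reasoning

  ratio*toℚ≡toℚ : ∀ m n .{{_ : ℕ.NonZero n}} → ratio m n * toℚ n ≡ toℚ m
  ratio*toℚ≡toℚ m (suc d) = toℚᵘ-injective (begin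
    toℚᵘ (ratio m (suc d) * toℚ (suc d))
      ≈⟨ toℚᵘ-homo-* (ratio m (suc d)) (toℚ (suc d)) ⟩
    toℚᵘ (ratio m (suc d)) ℚᵘ.* toℚᵘ (toℚ (suc d))
      ≈⟨ ℚᵘ.*-cong (toℚᵘ-fromℚᵘ (ℚᵘ.mkℚᵘ (+ m) d)) (ℚᵘ.≃-reflexive (toℚᵘ-toℚ (suc d))) ⟩
    ℚᵘ.mkℚᵘ (+ m) d ℚᵘ.* ℚᵘ.mkℚᵘ (+ suc d) 0
      ≈⟨ ℚᵘ.*≡* (ℤ.*-assoc (+ m) (+ suc d) (+ 1)) ⟩
    ℚᵘ.mkℚᵘ (+ m) 0
      ≡⟨ toℚᵘ-toℚ m ⟨
    toℚᵘ (toℚ m) ∎)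
    where open ℚᵘ.≃-Reasoning

  toℚ-cancel-< : ∀ {m n} → toℚ m < toℚ n → m ℕ.< n
  toℚ-cancel-< {m} {n} toℚm<toℚn rewrite toℚ≡mkℚ m | toℚ≡mkℚ n with toℚm<toℚn
  ... | *<* m*1<n*1 =
    ℤ.drop‿+<+ (subst₂ ℤ._<_ (ℤ.*-identityʳ (+ m)) (ℤ.*-identityʳ (+ n)) m*1<n*1)

  toℚ-pos : ∀ n .{{_ : ℕ.NonZero n}} → Positive (toℚ n)
  toℚ-pos (suc n) rewrite toℚ≡mkℚ (suc n) = _

  p<1∧p*n≡m⇒m<n : ∀ {p m n} .{{_ : ℕ.NonZero n}} → p < 1ℚ → p * toℚ n ≡ toℚ m → m ℕ.< n
  p<1∧p*n≡m⇒m<n {p} {m} {n} p<1 p*n≡m = toℚ-cancel-< (begin-strict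
    toℚ m       ≡⟨ p*n≡m ⟨
    p * toℚ n   <⟨ *-monoˡ-<-pos (toℚ n) {{toℚ-pos n}} p<1 ⟩
    1ℚ * toℚ n  ≡⟨ *-identityˡ (toℚ n) ⟩
    toℚ n       ∎)
    where open ≤-Reasoning

module SumTo where
  open import Data.Nat as ℕ using (ℕ; zero; suc; z≤n)
  import Data.Nat.Properties as ℕ
  open import Data.Rational
  open import Data.Rational.Properties
  open import Data.Rational.Solver using (module +-*-Solver)
  open import Function using (_∘_)
  open import Relation.Binary.PropositionalEquality
  open +-*-Solver using (solve; _:+_; _:-_; _:=_)

  sumTo-cong : ∀ k {g h : ℕ → ℚ} → (∀ {i} → i ℕ.≤ k → g i ≡ h i) → sumTo k g ≡ sumTo k h
  sumTo-cong zero    g≡h = g≡h z≤n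
  sumTo-cong (suc k) g≡h = cong₂ _+_ (sumTo-cong k (g≡h ∘ ℕ.m≤n⇒m≤1+n)) (g≡h ℕ.≤-refl)

  sumTo-head-tail : ∀ k (g : ℕ → ℚ) → sumTo (suc k) g ≡ g 0 + sumTo k (g ∘ suc)
  sumTo-head-tail zero    g = refl
  sumTo-head-tail (suc k) g =
    trans (cong (_+ g (suc (suc k))) (sumTo-head-tail k g)) (+-assoc (g 0) _ _)

  sumTo-difference : ∀ k (g h : ℕ → ℚ) → sumTo k (λ i → g i - h i) ≡ sumTo k g - sumTo k h
  sumTo-difference zero    g h = refl
  sumTo-difference (suc k) g h rewrite sumTo-difference k g h =
    solve 4 (λ a b c d → (a :- b) :+ (c :- d) := (a :+ c) :- (b :+ d)) refl
      (sumTo k g) (sumTo k h) (g (suc k)) (h (suc k))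

  sumTo-*ʳ : ∀ k (g : ℕ → ℚ) c → sumTo k g * c ≡ sumTo k (λ i → g i * c)
  sumTo-*ʳ zero    g c = refl
  sumTo-*ʳ (suc k) g c =
    trans (*-distribʳ-+ c (sumTo k g) (g (suc k))) (cong (_+ g (suc k) * c) (sumTo-*ʳ k g c))

  sumTo-vanishing : ∀ k (g : ℕ → ℚ) → (∀ i → g (suc i) ≡ 0ℚ) → sumTo k g ≡ g 0
  sumTo-vanishing zero    g g≡0 = refl
  sumTo-vanishing (suc k) g g≡0 rewrite sumTo-vanishing k g g≡0 | g≡0 k = +-identityʳ (g 0)

module Bound where
  open import Data.Nat as ℕ using (ℕ; zero; suc; _∸_; s≤s)
  import Data.Nat.Properties as ℕ
  open import Data.Nat.Combinatorics using (_C_; nCk+nC[k+1]≡[n+1]C[k+1])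
  open import Data.Rational
  open import Data.Rational.Properties
  open import Data.Rational.Solver using (module +-*-Solver)
  open import Function using (_∘_)
  open import Relation.Binary.PropositionalEquality
  open +-*-Solver using (solve; _:+_; _:*_; :-_; _:-_; _:=_)
  open Binomial
  open Embedding
  open SumTo

  -- Inclusion–exclusion count of the k-subsets of a q-set avoiding a fixed v-subset.
  signedCount : ℕ → ℕ → ℕ → ℚ
  signedCount q v k = sumTo k (λ i → sgn i * toℚ ((v C i) ℕ.* ((q ∸ i) C (k ∸ i))))

  signedCount-pascal : ∀ q v k →
    signedCount (suc q) (suc v) (suc k) ≡ signedCount (suc q) v (suc k) - signedCount q v k
  signedCount-pascal q v k = begin
    signedCount (suc q) (suc v) (suc k)
      ≡⟨ sumTo-head-tail k _ ⟩
    term 0 + sumTo k (λ i → sgn (suc i) * toℚ ((suc v C suc i) ℕ.* Y i))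
      ≡⟨ cong (term 0 +_) (sumTo-cong k (λ {i} _ → pascal i)) ⟩
    term 0 + sumTo k (λ i → term (suc i) - previous i)
      ≡⟨ cong (term 0 +_) (sumTo-difference k (term ∘ suc) previous) ⟩
    term 0 + (sumTo k (term ∘ suc) - signedCount q v k)
      ≡⟨ +-assoc (term 0) _ _ ⟨
    (term 0 + sumTo k (term ∘ suc)) - signedCount q v k
      ≡⟨ cong (_- signedCount q v k) (sumTo-head-tail k term) ⟨
    signedCount (suc q) v (suc k) - signedCount q v k ∎
    where
    open ≡-Reasoning
    Y : ℕ → ℕ
    Y i = (q ∸ i) C (k ∸ i)
    term : ℕ → ℚ
    term i = sgn i * toℚ ((v C i) ℕ.* ((suc q ∸ i) C (suc k ∸ i)))
    previous : ℕ → ℚ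
    previous i = sgn i * toℚ ((v C i) ℕ.* Y i)
    pascal : ∀ i → sgn (suc i) * toℚ ((suc v C suc i) ℕ.* Y i) ≡ term (suc i) - previous i
    pascal i = begin
      - sgn i * toℚ ((suc v C suc i) ℕ.* Y i)
        ≡⟨ cong (λ n → - sgn i * toℚ (n ℕ.* Y i)) (nCk+nC[k+1]≡[n+1]C[k+1] v i) ⟨
      - sgn i * toℚ ((v C i ℕ.+ v C suc i) ℕ.* Y i)
        ≡⟨ cong (λ n → - sgn i * toℚ n) (ℕ.*-distribʳ-+ (Y i) (v C i) (v C suc i)) ⟩
      - sgn i * toℚ (a ℕ.+ b)
        ≡⟨ cong (- sgn i *_) (toℚ-+ a b) ⟩
      - sgn i * (toℚ a + toℚ b)
        ≡⟨ solve 3 (λ s a b → (:- s) :* (a :+ b) := (:- s) :* b :- s :* a) refl (sgn i) (toℚ a) (toℚ b) ⟩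
      - sgn i * toℚ b - sgn i * toℚ a ∎
      where
      a b : ℕ
      a = (v C i) ℕ.* Y i
      b = (v C suc i) ℕ.* Y i

  signedCount≡[q∸v]Ck : ∀ {q v} k → v ℕ.≤ q → signedCount q v k ≡ toℚ ((q ∸ v) C k)
  signedCount≡[q∸v]Ck {q} {zero} k _ = begin
    signedCount q 0 k         ≡⟨ sumTo-vanishing k _ (λ i → *-zeroʳ (sgn (suc i))) ⟩
    1ℚ * toℚ (1 ℕ.* (q C k))  ≡⟨ *-identityˡ _ ⟩
    toℚ (1 ℕ.* (q C k))       ≡⟨ cong toℚ (ℕ.*-identityˡ (q C k)) ⟩
    toℚ (q C k)               ∎
    where open ≡-Reasoning
  signedCount≡[q∸v]Ck {suc q} {suc v} zero    _ = refl
  signedCount≡[q∸v]Ck {suc q} {suc v} (suc k) (s≤s v≤q) = begin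
    signedCount (suc q) (suc v) (suc k)
      ≡⟨ signedCount-pascal q v k ⟩
    signedCount (suc q) v (suc k) - signedCount q v k
      ≡⟨ cong₂ _-_ (signedCount≡[q∸v]Ck (suc k) (ℕ.m≤n⇒m≤1+n v≤q)) (signedCount≡[q∸v]Ck k v≤q) ⟩
    toℚ ((suc q ∸ v) C suc k) - toℚ c
      ≡⟨ cong (λ n → toℚ (n C suc k) - toℚ c) (ℕ.+-∸-assoc 1 v≤q) ⟩
    toℚ (suc (q ∸ v) C suc k) - toℚ c
      ≡⟨ cong (λ n → toℚ n - toℚ c) (nCk+nC[k+1]≡[n+1]C[k+1] (q ∸ v) k) ⟨
    toℚ (c ℕ.+ c′) - toℚ c
      ≡⟨ cong (_- toℚ c) (toℚ-+ c c′) ⟩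
    toℚ c + toℚ c′ - toℚ c
      ≡⟨ solve 2 (λ a b → a :+ b :- a := b) refl (toℚ c) (toℚ c′) ⟩
    toℚ c′ ∎
    where
    open ≡-Reasoning
    c c′ : ℕ
    c  = (q ∸ v) C k
    c′ = (q ∸ v) C suc k

  bound*qCk≡q*[q∸v]Ck : ∀ {q v k} → k ℕ.≤ q → v ℕ.≤ q →
                        bound q v k * toℚ (q C k) ≡ toℚ (q ℕ.* ((q ∸ v) C k))
  bound*qCk≡q*[q∸v]Ck {q} {v} {k} k≤q v≤q = begin
    toℚ q * sumTo k term * toℚ (q C k)            ≡⟨ *-assoc (toℚ q) _ _ ⟩
    toℚ q * (sumTo k term * toℚ (q C k))          ≡⟨ cong (toℚ q *_) (sumTo-*ʳ k term _) ⟩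
    toℚ q * sumTo k (λ i → term i * toℚ (q C k))  ≡⟨ cong (toℚ q *_) (sumTo-cong k scaled-term) ⟩
    toℚ q * signedCount q v k                     ≡⟨ cong (toℚ q *_) (signedCount≡[q∸v]Ck k v≤q) ⟩
    toℚ q * toℚ ((q ∸ v) C k)                     ≡⟨ toℚ-* q _ ⟨
    toℚ (q ℕ.* ((q ∸ v) C k))                     ∎
    where
    open ≡-Reasoning
    term : ℕ → ℚ
    term i = sgn i * (toℚ (k C i) * ratio (v C i) (q C i))
    scaled-term : ∀ {i} → i ℕ.≤ k →
                  term i * toℚ (q C k) ≡ sgn i * toℚ ((v C i) ℕ.* ((q ∸ i) C (k ∸ i)))
    scaled-term {i} i≤k = begin
      sgn i * (toℚ (k C i) * r) * toℚ (q C k)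
        ≡⟨ solve 4 (λ s a r b → s :* (a :* r) :* b := s :* (r :* (b :* a))) refl
                 (sgn i) (toℚ (k C i)) r (toℚ (q C k)) ⟩
      sgn i * (r * (toℚ (q C k) * toℚ (k C i)))
        ≡⟨ cong (λ x → sgn i * (r * x)) qCk*kCi≡qCi*Y ⟩
      sgn i * (r * (toℚ (q C i) * toℚ Y))
        ≡⟨ cong (sgn i *_) (*-assoc r (toℚ (q C i)) (toℚ Y)) ⟨
      sgn i * (r * toℚ (q C i) * toℚ Y)
        ≡⟨ cong (λ x → sgn i * (x * toℚ Y)) (ratio*toℚ≡toℚ (v C i) (q C i) {{qCi≢0}}) ⟩
      sgn i * (toℚ (v C i) * toℚ Y)
        ≡⟨ cong (sgn i *_) (toℚ-* (v C i) Y) ⟨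
      sgn i * toℚ ((v C i) ℕ.* Y) ∎
      where
      r : ℚ
      r = ratio (v C i) (q C i)
      Y : ℕ
      Y = (q ∸ i) C (k ∸ i)
      qCi≢0 : ℕ.NonZero (q C i)
      qCi≢0 = nCk≢0 (ℕ.≤-trans i≤k k≤q)
      qCk*kCi≡qCi*Y : toℚ (q C k) * toℚ (k C i) ≡ toℚ (q C i) * toℚ Y
      qCk*kCi≡qCi*Y = begin
        toℚ (q C k) * toℚ (k C i)  ≡⟨ toℚ-* (q C k) (k C i) ⟨
        toℚ ((q C k) ℕ.* (k C i))  ≡⟨ cong toℚ (nCi*[n∸i]C[k∸i]≡nCk*kCi i≤k k≤q) ⟨
        toℚ ((q C i) ℕ.* Y)        ≡⟨ toℚ-* (q C i) Y ⟩
        toℚ (q C i) * toℚ Y        ∎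

  bound<1⇒q*[q∸v]Ck<qCk : ∀ {q v k} → k ℕ.≤ q → v ℕ.≤ q → bound q v k < 1ℚ →
                          q ℕ.* ((q ∸ v) C k) ℕ.< q C k
  bound<1⇒q*[q∸v]Ck<qCk k≤q v≤q bound<1 =
    p<1∧p*n≡m⇒m<n {{nCk≢0 k≤q}} bound<1 (bound*qCk≡q*[q∸v]Ck k≤q v≤q)

module Subsets where
  open import Data.Nat
  open import Data.Nat.Properties
  open import Data.Nat.Combinatorics using (_C_; nCk+nC[k+1]≡[n+1]C[k+1])
  open import Data.Bool using (Bool; true; false; not; _∧_)
  open import Data.Fin using (zero; suc)
  open import Data.Fin.Subset using (inside; outside)
  open import Data.Fin.Subset.Properties using (∣p∣≤n)
  open import Data.Vec using ([]; _∷_; here; there)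
  open import Data.List using (List; []; _∷_; [_]; map; _++_; length)
  open import Data.Nat.ListAction using (sum)
  open import Data.List.Properties using (length-++; length-map; map-++)
  open import Data.List.Relation.Unary.All using (All; []; _∷_)
  import Data.List.Relation.Unary.All as All
  open import Data.List.Relation.Unary.All.Properties using (map⁺; ++⁺)
  open import Data.Nat.ListAction.Properties using (sum-++)
  open import Data.Product using (∃; _×_; _,_)
  open import Relation.Binary.PropositionalEquality hiding ([_])

  subsetsOfSize : (n k : ℕ) → List (Subset n)
  subsetsOfSize zero    zero    = [ [] ]
  subsetsOfSize zero    (suc k) = []
  subsetsOfSize (suc n) zero    = map (outside ∷_) (subsetsOfSize n zero)
  subsetsOfSize (suc n) (suc k) =
    map (outside ∷_) (subsetsOfSize n (suc k)) ++ map (inside ∷_) (subsetsOfSize n k)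

  subsetsOfSize-∣∣≡ : ∀ n k → All (λ S → ∣ S ∣ ≡ k) (subsetsOfSize n k)
  subsetsOfSize-∣∣≡ zero    zero    = refl ∷ []
  subsetsOfSize-∣∣≡ zero    (suc k) = []
  subsetsOfSize-∣∣≡ (suc n) zero    = map⁺ (subsetsOfSize-∣∣≡ n zero)
  subsetsOfSize-∣∣≡ (suc n) (suc k) =
    ++⁺ (map⁺ (subsetsOfSize-∣∣≡ n (suc k))) (map⁺ (All.map (cong suc) (subsetsOfSize-∣∣≡ n k)))

  length-subsetsOfSize : ∀ n k → length (subsetsOfSize n k) ≡ n C k
  length-subsetsOfSize zero    zero    = refl
  length-subsetsOfSize zero    (suc k) = refl
  length-subsetsOfSize (suc n) zero    =
    trans (length-map (outside ∷_) (subsetsOfSize n zero)) (length-subsetsOfSize n zero)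
  length-subsetsOfSize (suc n) (suc k) = begin
    length (map (outside ∷_) Ss ++ map (inside ∷_) Ts)
      ≡⟨ length-++ (map (outside ∷_) Ss) ⟩
    length (map (outside ∷_) Ss) + length (map (inside ∷_) Ts)
      ≡⟨ cong₂ _+_ (length-map (outside ∷_) Ss) (length-map (inside ∷_) Ts) ⟩
    length Ss + length Ts
      ≡⟨ cong₂ _+_ (length-subsetsOfSize n (suc k)) (length-subsetsOfSize n k) ⟩
    n C suc k + n C k
      ≡⟨ +-comm (n C suc k) (n C k) ⟩
    n C k + n C suc k
      ≡⟨ nCk+nC[k+1]≡[n+1]C[k+1] n k ⟩
    suc n C suc k ∎
    where
    open ≡-Reasoning
    Ss Ts : List (Subset n)
    Ss = subsetsOfSize n (suc k)
    Ts = subsetsOfSize n k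

  disjoint : ∀ {n} → Subset n → Subset n → Bool
  disjoint []      []      = true
  disjoint (x ∷ S) (y ∷ A) = not (x ∧ y) ∧ disjoint S A

  disjoint≡false⇒∃ : ∀ {n} (S A : Subset n) → disjoint S A ≡ false → ∃ λ s → s ∈ S × s ∈ A
  disjoint≡false⇒∃ []          []          ()
  disjoint≡false⇒∃ (true  ∷ S) (true  ∷ A) _ = zero , here , here
  disjoint≡false⇒∃ (true  ∷ S) (false ∷ A) ≡false with disjoint≡false⇒∃ S A ≡false
  ... | s , s∈S , s∈A = suc s , there s∈S , there s∈A
  disjoint≡false⇒∃ (false ∷ S) (y     ∷ A) ≡false with disjoint≡false⇒∃ S A ≡false
  ... | s , s∈S , s∈A = suc s , there s∈S , there s∈A

  indicator : Bool → ℕ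
  indicator true  = 1
  indicator false = 0

  indicator≡0 : ∀ {b} → indicator b ≡ 0 → b ≡ false
  indicator≡0 {false} _ = refl

  #disjoint : ∀ {n} → Subset n → List (Subset n) → ℕ
  #disjoint A Ss = sum (map (λ S → indicator (disjoint S A)) Ss)

  #disjoint-++ : ∀ {n} (A : Subset n) Ss Ts → #disjoint A (Ss ++ Ts) ≡ #disjoint A Ss + #disjoint A Ts
  #disjoint-++ A Ss Ts = trans (cong sum (map-++ _ Ss Ts)) (sum-++ (map _ Ss) _)

  #disjoint-map-outside∷ : ∀ {n} b (A : Subset n) Ss →
                           #disjoint (b ∷ A) (map (outside ∷_) Ss) ≡ #disjoint A Ss
  #disjoint-map-outside∷ b A []       = refl
  #disjoint-map-outside∷ b A (S ∷ Ss) =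
    cong (indicator (disjoint S A) +_) (#disjoint-map-outside∷ b A Ss)

  #disjoint[outside∷]-map-inside∷ : ∀ {n} (A : Subset n) Ss →
                                    #disjoint (outside ∷ A) (map (inside ∷_) Ss) ≡ #disjoint A Ss
  #disjoint[outside∷]-map-inside∷ A []       = refl
  #disjoint[outside∷]-map-inside∷ A (S ∷ Ss) =
    cong (indicator (disjoint S A) +_) (#disjoint[outside∷]-map-inside∷ A Ss)

  #disjoint[inside∷]-map-inside∷≡0 : ∀ {n} (A : Subset n) Ss →
                                     #disjoint (inside ∷ A) (map (inside ∷_) Ss) ≡ 0
  #disjoint[inside∷]-map-inside∷≡0 A []       = refl
  #disjoint[inside∷]-map-inside∷≡0 A (S ∷ Ss) = #disjoint[inside∷]-map-inside∷≡0 A Ss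

  #disjoint-subsetsOfSize : ∀ n k (A : Subset n) → #disjoint A (subsetsOfSize n k) ≡ (n ∸ ∣ A ∣) C k
  #disjoint-subsetsOfSize zero    zero    []      = refl
  #disjoint-subsetsOfSize zero    (suc k) []      = refl
  #disjoint-subsetsOfSize (suc n) zero    (b ∷ A) =
    trans (#disjoint-map-outside∷ b A (subsetsOfSize n zero)) (#disjoint-subsetsOfSize n zero A)
  #disjoint-subsetsOfSize (suc n) (suc k) (true ∷ A) = begin
    #disjoint (inside ∷ A) (map (outside ∷_) Ss ++ map (inside ∷_) Ts)
      ≡⟨ #disjoint-++ (inside ∷ A) (map (outside ∷_) Ss) (map (inside ∷_) Ts) ⟩
    #disjoint (inside ∷ A) (map (outside ∷_) Ss) + #disjoint (inside ∷ A) (map (inside ∷_) Ts)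
      ≡⟨ cong₂ _+_ (#disjoint-map-outside∷ inside A Ss) (#disjoint[inside∷]-map-inside∷≡0 A Ts) ⟩
    #disjoint A Ss + 0
      ≡⟨ +-identityʳ _ ⟩
    #disjoint A Ss
      ≡⟨ #disjoint-subsetsOfSize n (suc k) A ⟩
    (n ∸ ∣ A ∣) C suc k ∎
    where
    open ≡-Reasoning
    Ss Ts : List (Subset n)
    Ss = subsetsOfSize n (suc k)
    Ts = subsetsOfSize n k
  #disjoint-subsetsOfSize (suc n) (suc k) (false ∷ A) = begin
    #disjoint (outside ∷ A) (map (outside ∷_) Ss ++ map (inside ∷_) Ts)
      ≡⟨ #disjoint-++ (outside ∷ A) (map (outside ∷_) Ss) (map (inside ∷_) Ts) ⟩
    #disjoint (outside ∷ A) (map (outside ∷_) Ss) + #disjoint (outside ∷ A) (map (inside ∷_) Ts)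
      ≡⟨ cong₂ _+_ (#disjoint-map-outside∷ outside A Ss) (#disjoint[outside∷]-map-inside∷ A Ts) ⟩
    #disjoint A Ss + #disjoint A Ts
      ≡⟨ cong₂ _+_ (#disjoint-subsetsOfSize n (suc k) A) (#disjoint-subsetsOfSize n k A) ⟩
    m C suc k + m C k
      ≡⟨ +-comm (m C suc k) (m C k) ⟩
    m C k + m C suc k
      ≡⟨ nCk+nC[k+1]≡[n+1]C[k+1] m k ⟩
    suc m C suc k
      ≡⟨ cong (_C suc k) (+-∸-assoc 1 (∣p∣≤n A)) ⟨
    (suc n ∸ ∣ A ∣) C suc k ∎
    where
    open ≡-Reasoning
    Ss Ts : List (Subset n)
    Ss = subsetsOfSize n (suc k)
    Ts = subsetsOfSize n k
    m : ℕ
    m = n ∸ ∣ A ∣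

  sum<length⇒∃≡0 : ∀ {A : Set} {P : A → Set} (u : A → ℕ) {xs} →
                   All P xs → sum (map u xs) < length xs → ∃ λ x → P x × u x ≡ 0
  sum<length⇒∃≡0 u {x ∷ xs} (px ∷ pxs) sum<length with u x in ux≡
  ... | zero  = x , px , ux≡
  ... | suc m = sum<length⇒∃≡0 u pxs (≤-trans (s≤s (m≤n+m _ m)) (s≤s⁻¹ sum<length))

module FinSums where
  open import Data.Nat
  open import Data.Nat.Properties using (+-0-commutativeMonoid; m+n≡0⇒m≡0; m+n≡0⇒n≡0)
  open import Data.Nat.ListAction using (sum)
  open import Data.Bool using (true; false)
  open import Data.Fin using (zero; suc)
  open import Data.Fin.Permutation using (Permutation′; _⟨$⟩ʳ_)
  open import Data.Vec using ([]; _∷_; lookup; tabulate)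
  open import Data.Vec.Properties using (lookup∘tabulate)
  open import Data.List using (List; []; _∷_; map)
  open import Function using (_∘_)
  open import Relation.Binary.PropositionalEquality
  open import Algebra.Properties.CommutativeMonoid.Sum +-0-commutativeMonoid
    using (sum-syntax; ∑-distrib-+; sum-permute; sum-cong-≗; sum-replicate-zero)
    renaming (sum to ∑)
  open Subsets using (indicator)

  ∑-const : ∀ n c → ∑[ i < n ] c ≡ n * c
  ∑-const zero    c = refl
  ∑-const (suc n) c = cong (c +_) (∑-const n c)

  ∑≡0⇒≡0 : ∀ {n} (f : Fin n → ℕ) → ∑ f ≡ 0 → ∀ i → f i ≡ 0
  ∑≡0⇒≡0 f ∑f≡0 zero    = m+n≡0⇒m≡0 (f zero) ∑f≡0
  ∑≡0⇒≡0 f ∑f≡0 (suc i) = ∑≡0⇒≡0 (f ∘ suc) (m+n≡0⇒n≡0 (f zero) ∑f≡0) i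

  sum-map-∑ : ∀ {A : Set} {n} (f : A → Fin n → ℕ) (xs : List A) →
              sum (map (λ x → ∑[ i < n ] f x i) xs) ≡ ∑[ i < n ] sum (map (λ x → f x i) xs)
  sum-map-∑ {n = n} f []       = sym (sum-replicate-zero n)
  sum-map-∑         f (x ∷ xs) = trans (cong (∑ (f x) +_) (sum-map-∑ f xs))
                                       (sym (∑-distrib-+ (f x) (λ i → sum (map (λ y → f y i) xs))))

  ∣p∣≡∑ : ∀ {n} (p : Subset n) → ∣ p ∣ ≡ ∑[ i < n ] indicator (lookup p i)
  ∣p∣≡∑ []          = refl
  ∣p∣≡∑ (true  ∷ p) = cong suc (∣p∣≡∑ p)
  ∣p∣≡∑ (false ∷ p) = ∣p∣≡∑ p

  ∣p∘π∣≡∣p∣ : ∀ {n} (π : Permutation′ n) (p : Subset n) →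
              ∣ tabulate (lookup p ∘ (π ⟨$⟩ʳ_)) ∣ ≡ ∣ p ∣
  ∣p∘π∣≡∣p∣ {n} π p = begin
    ∣ tabulate (lookup p ∘ π′) ∣
      ≡⟨ ∣p∣≡∑ (tabulate (lookup p ∘ π′)) ⟩
    ∑[ i < n ] indicator (lookup (tabulate (lookup p ∘ π′)) i)
      ≡⟨ sum-cong-≗ (cong indicator ∘ lookup∘tabulate (lookup p ∘ π′)) ⟩
    ∑[ i < n ] indicator (lookup p (π′ i))
      ≡⟨ sum-permute (indicator ∘ lookup p) π ⟨
    ∑[ i < n ] indicator (lookup p i)
      ≡⟨ ∣p∣≡∑ p ⟨
    ∣ p ∣ ∎
    where
    open ≡-Reasoning
    π′ : Fin n → Fin n
    π′ = π ⟨$⟩ʳ_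

module Covering {q} {_⊕_ : Op₂ (Fin q)} {e : Fin q} {⊖_ : Op₁ (Fin q)}
                (isGroup : IsGroup _≡_ _⊕_ e ⊖_) (P : Subset q) where
  open import Data.Nat using (ℕ; _*_; _∸_; _<_)
  open import Data.Nat.Properties using (+-0-commutativeMonoid)
  open import Data.Nat.ListAction using (sum)
  open import Data.Nat.Combinatorics using (_C_)
  open import Data.Bool using (false)
  open import Data.Fin.Permutation using (Permutation′; permutation; flip; _⟨$⟩ˡ_; inverseʳ)
  open import Data.Vec using (lookup; tabulate)
  open import Data.Vec.Properties using (lookup∘tabulate; []=⇒lookup; lookup⇒[]=)
  open import Data.List using (map; length)
  open import Data.Product using (Σ; ∃; _×_; _,_)
  open import Algebra.Bundles using (Group)
  import Algebra.Properties.Group as GroupProperties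
  open import Algebra.Properties.CommutativeMonoid.Sum +-0-commutativeMonoid
    using (sum-syntax; sum-cong-≗)
  open import Level using (0ℓ)
  open import Function using (_∘_)
  open import Relation.Binary.PropositionalEquality
  open Subsets
  open FinSums

  open IsGroup isGroup using (_\\_; _//_)

  group : Group 0ℓ 0ℓ
  group = record { isGroup = isGroup }

  open GroupProperties group using (\\-leftDividesˡ; \\-leftDividesʳ; ⁻¹-involutive)

  subtractFrom : Fin q → Permutation′ q
  subtractFrom r = permutation (r //_) (λ s → ⊖ (r \\ s)) r//⊖[r\\s]≡s ⊖[r\\[r//c]]≡c
    where
    r//⊖[r\\s]≡s : ∀ s → r // ⊖ (r \\ s) ≡ s
    r//⊖[r\\s]≡s s = trans (cong (r ⊕_) (⁻¹-involutive (r \\ s))) (\\-leftDividesˡ r s)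
    ⊖[r\\[r//c]]≡c : ∀ c → ⊖ (r \\ (r // c)) ≡ c
    ⊖[r\\[r//c]]≡c c = trans (cong ⊖_ (\\-leftDividesʳ r (⊖ c))) (⁻¹-involutive c)

  -- Row r of the subtraction table of P: the set of all r ⊕ ⊖ c with c ∈ P.
  row : Fin q → Subset q
  row r = tabulate (lookup P ∘ (subtractFrom r ⟨$⟩ˡ_))

  ∣row∣≡∣P∣ : ∀ r → ∣ row r ∣ ≡ ∣ P ∣
  ∣row∣≡∣P∣ r = ∣p∘π∣≡∣p∣ (flip (subtractFrom r)) P

  uncovered : Subset q → ℕ
  uncovered S = ∑[ r < q ] indicator (disjoint S (row r))

  ∑uncovered≡q*[q∸∣P∣]Ck : ∀ k → sum (map uncovered (subsetsOfSize q k)) ≡ q * ((q ∸ ∣ P ∣) C k)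
  ∑uncovered≡q*[q∸∣P∣]Ck k = begin
    sum (map uncovered (subsetsOfSize q k))
      ≡⟨ sum-map-∑ (λ S r → indicator (disjoint S (row r))) (subsetsOfSize q k) ⟩
    ∑[ r < q ] #disjoint (row r) (subsetsOfSize q k)
      ≡⟨ sum-cong-≗ (λ r → #disjoint-subsetsOfSize q k (row r)) ⟩
    ∑[ r < q ] ((q ∸ ∣ row r ∣) C k)
      ≡⟨ sum-cong-≗ (λ r → cong (λ m → (q ∸ m) C k) (∣row∣≡∣P∣ r)) ⟩
    ∑[ r < q ] ((q ∸ ∣ P ∣) C k)
      ≡⟨ ∑-const q ((q ∸ ∣ P ∣) C k) ⟩
    q * ((q ∸ ∣ P ∣) C k) ∎
    where open ≡-Reasoning

  meets-row⇒covered : ∀ S r → disjoint S (row r) ≡ false → ∃ λ c → c ∈ P × (r ⊕ (⊖ c)) ∈ S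
  meets-row⇒covered S r S∩row≢∅ with disjoint≡false⇒∃ S (row r) S∩row≢∅
  ... | s , s∈S , s∈row = c , c∈P , subst (_∈ S) (sym (inverseʳ (subtractFrom r))) s∈S
    where
    c : Fin q
    c = subtractFrom r ⟨$⟩ˡ s
    c∈P : c ∈ P
    c∈P = lookup⇒[]= c P (trans (sym (lookup∘tabulate (lookup P ∘ (subtractFrom r ⟨$⟩ˡ_)) s))
                                ([]=⇒lookup s∈row))

  cover-of-size : ∀ k → q * ((q ∸ ∣ P ∣) C k) < q C k →
                  Σ (Subset q) λ S → ∣ S ∣ ≡ k
                    × ((r : Fin q) → ∃ λ c → c ∈ P × (r ⊕ (⊖ c)) ∈ S)
  cover-of-size k q*[q∸∣P∣]Ck<qCk
    with sum<length⇒∃≡0 uncovered (subsetsOfSize-∣∣≡ q k) #uncovered<#subsets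
    where
    #uncovered<#subsets : sum (map uncovered (subsetsOfSize q k)) < length (subsetsOfSize q k)
    #uncovered<#subsets =
      subst₂ _<_ (sym (∑uncovered≡q*[q∸∣P∣]Ck k)) (sym (length-subsetsOfSize q k)) q*[q∸∣P∣]Ck<qCk
  ... | S , ∣S∣≡k , uncovered≡0 =
    S , ∣S∣≡k , λ r → meets-row⇒covered S r (indicator≡0 (∑≡0⇒≡0 _ uncovered≡0 r))

open import Data.Nat using (ℕ; _≤_)
open import Data.Rational using (_<_; 1ℚ)
open import Data.Fin.Subset.Properties using (∣p∣≤n)
open import Data.Product using (Σ; ∃; _×_)
open Bound using (bound<1⇒q*[q∸v]Ck<qCk)
open Covering using (cover-of-size)

theorem6p1 : (q : ℕ) (_⊕_ : Op₂ (Fin q)) (e : Fin q) (⊖_ : Op₁ (Fin q))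
    → IsGroup _≡_ _⊕_ e ⊖_
    → (f : Fin q → Fin q) (v : ℕ) → V f ≡ v
    → (k : ℕ) → 1 ≤ k → k ≤ q
    → bound q v k < 1ℚ
    → Σ (Subset q) (λ S → ∣ S ∣ ≡ k
         × ((r : Fin q) → ∃ (λ c → c ∈ Im f × (r ⊕ (⊖ c)) ∈ S)))
theorem6p1 q _⊕_ e ⊖_ isGroup f .(V f) refl k _ k≤q bound<1 =
  cover-of-size isGroup (Im f) k (bound<1⇒q*[q∸v]Ck<qCk k≤q (∣p∣≤n (Im f)) bound<1)
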